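{- Let $a,b,c$ be complex numbers and define, for integers $n\ge0$, $$\Omega_n(a,b,c):=\sum_{k=0}^{n-1}q^k\frac{(b/q;q)_k(cq;q)_{2k}}{(aq^3,c/(aq);q)_k(bcq^2;q^3)_k}.$$ Then for every integer $n\ge0$ (whenever no denominator vanishes) $$\Omega_n(a,b,c)=\frac{c(q-b)(aq;q)_2}{(b-aq^3)(1-c)(aq-c)}\Omega_n(a/q^2,bq,c/q)+\frac{q(1-aq^2)(1-bc/q)}{(b-aq^3)(1-c)}\left\{1-\frac{(b/q;q)_n(c;q)_{2n}}{(aq^2,c/(aq);q)_n(bc/q;q^3)_n}\right\}.$$
   Context: $q$ is a complex number with $|q|<1$. For a base $p$ and integer $k\ge0$, $(z;p)_k:=\prod_{j=0}^{k-1}(1-zp^j)$, and $(z_1,\dots,z_m;p)_k:=(z_1;p)_k\cdots(z_m;p)_k$. -}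

module Defs where

open import Level using (Level; _⊔_) renaming (suc to lsuc)
open import Data.Nat using (ℕ; zero; suc; _<_; _≤_)
import Data.Nat as ℕ
open import Algebra.Bundles using (CommutativeRing)
open import Relation.Nullary using (¬_)

-- A field: a commutative ring with 0 ≠ 1 and a total inverse operation
-- which is a genuine inverse on every nonzero element (ℂ is an instance).
record Field (c ℓ : Level) : Set (lsuc (c ⊔ ℓ)) where
  field
    commutativeRing : CommutativeRing c ℓ
  open CommutativeRing commutativeRing public
  field
    _⁻¹       : Carrier → Carrier
    ⁻¹-cong   : ∀ {x y} → x ≈ y → x ⁻¹ ≈ y ⁻¹
    ⁻¹-inverse : ∀ x → ¬ (x ≈ 0#) → x * (x ⁻¹) ≈ 1#
    0≉1       : ¬ (0# ≈ 1#)

module FieldOps {c ℓ : Level} (F : Field c ℓ) where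
  open Field F

  infixl 7 _∕_
  infixr 8 _^′_
  infixl 6 _⊖_

  _⊖_ : Carrier → Carrier → Carrier
  x ⊖ y = x + (- y)

  _∕_ : Carrier → Carrier → Carrier
  x ∕ y = x * (y ⁻¹)

  _^′_ : Carrier → ℕ → Carrier
  x ^′ zero  = 1#
  x ^′ suc k = (x ^′ k) * x

  poch : Carrier → Carrier → ℕ → Carrier
  poch z p zero    = 1#
  poch z p (suc k) = poch z p k * (1# ⊖ z * (p ^′ k))

  sumTo : ℕ → (ℕ → Carrier) → Carrier
  sumTo zero    f = 0#
  sumTo (suc n) f = sumTo n f + f n

  Ωden : (q a b c : Carrier) → ℕ → Carrier
  Ωden q a b c k =
    poch (a * q ^′ 3) q k * poch (c ∕ (a * q)) q k * poch (b * c * q ^′ 2) (q ^′ 3) k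

  Ω : (q : Carrier) → ℕ → (a b c : Carrier) → Carrier
  Ω q n a b c = sumTo n λ k →
    (q ^′ k) * poch (b ∕ q) q k * poch (c * q) q (2 ℕ.* k) ∕ Ωden q a b c k

{-# OPTIONS --safe #-}
-- Write Ω_n(a,b,c) = Σ_{k<n} T_k and let R_k := (b/q;q)_k (c;q)_{2k} / ((aq²,c/(aq);q)_k (bc/q;q³)_k),
-- the quotient in braces, so that R_0 = 1.  The identity telescopes once
-- T_k = A T′_k + B (R_k − R_{k+1}) for every k, where T′ is the summand of Ω_n(a/q²,bq,c/q) and A, B
-- are the two coefficients.  Via (z;p)_{k+1} = (1 − z)(zp;p)_k, each of T_k, A T′_k and
-- B (R_k − R_{k+1}) is R_k times an explicit rational function of x = q^k; all comparisons are made
-- by cross-multiplication, so no possibly vanishing factor is ever inverted.  Over the common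
-- denominator the step becomes a single polynomial identity in q, a, b, c and x.
module Submission where

open import Defs
open import Level using (Level)
open import Data.Nat using (ℕ; _<_)
open import Relation.Nullary using (¬_)

open import Data.Maybe using (Maybe; just; nothing)
open import Data.Nat as ℕ using (zero; suc)
open import Data.Integer as ℤ using (ℤ; +_; -[1+_])
import Data.Integer.Properties as ℤ
import Data.Nat.Properties as ℕ
open import Data.Sign as Sign using (Sign)
open import Relation.Nullary using (yes; no)
import Relation.Binary.PropositionalEquality as ≡
open import Algebra.Bundles using (CommutativeRing)
open import Algebra.Solver.Ring.AlmostCommutativeRing
  using (_-Raw-AlmostCommutative⟶_; fromCommutativeRing)

-- The ring solver normalises coefficients, so it needs ones with decidable equality: the integers.
module ℤ-RingSolver {c ℓ : Level} (R : CommutativeRing c ℓ) where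
  open CommutativeRing R
  open import Algebra.Properties.Semiring.Mult.TCOptimised semiring
  open import Algebra.Properties.Ring ring
    using (-‿involutive; -‿distribˡ-*; -‿distribʳ-*; -‿+-comm; -0#≈0#)
  open import Algebra.Properties.CommutativeSemigroup *-commutativeSemigroup
    using () renaming (interchange to *-interchange)
  open import Algebra.Properties.CommutativeSemigroup +-commutativeSemigroup
    using () renaming (interchange to +-interchange)
  open import Relation.Binary.Reasoning.Setoid setoid

  fromSign : Sign → Carrier
  fromSign Sign.+ = 1#
  fromSign Sign.- = - 1#

  fromℤ : ℤ → Carrier
  fromℤ (+ n)    = n × 1#
  fromℤ -[1+ n ] = - (suc n × 1#)

  fromSign-* : ∀ s t → fromSign (s Sign.* t) ≈ fromSign s * fromSign t
  fromSign-* Sign.+ t      = sym (*-identityˡ _)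
  fromSign-* Sign.- Sign.+ = sym (*-identityʳ _)
  fromSign-* Sign.- Sign.- = begin
    1#              ≈⟨ -‿involutive 1# ⟨
    - - 1#          ≈⟨ -‿cong (*-identityʳ (- 1#)) ⟨
    - (- 1# * 1#)   ≈⟨ -‿distribʳ-* (- 1#) 1# ⟩
    - 1# * - 1#     ∎

  fromℤ-◃ : ∀ s n → fromℤ (s ℤ.◃ n) ≈ fromSign s * (n × 1#)
  fromℤ-◃ s      zero    = sym (zeroʳ _)
  fromℤ-◃ Sign.+ (suc n) = sym (*-identityˡ _)
  fromℤ-◃ Sign.- (suc n) = trans (-‿cong (sym (*-identityˡ _))) (-‿distribˡ-* 1# _)

  fromℤ-signAbs : ∀ i → fromℤ i ≈ fromSign (ℤ.sign i) * (ℤ.∣ i ∣ × 1#)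
  fromℤ-signAbs i =
    ≡.subst (λ j → fromℤ j ≈ fromSign (ℤ.sign i) * (ℤ.∣ i ∣ × 1#)) (ℤ.◃-inverse i)
      (fromℤ-◃ (ℤ.sign i) ℤ.∣ i ∣)

  fromℤ-* : ∀ i j → fromℤ (i ℤ.* j) ≈ fromℤ i * fromℤ j
  fromℤ-* i j = begin
    fromℤ (i ℤ.* j)                      ≈⟨ fromℤ-◃ (s Sign.* t) (ℤ.∣ i ∣ ℕ.* ℤ.∣ j ∣) ⟩
    fromSign (s Sign.* t) * ((ℤ.∣ i ∣ ℕ.* ℤ.∣ j ∣) × 1#)
                                         ≈⟨ *-cong (fromSign-* s t) (×1-homo-* ℤ.∣ i ∣ ℤ.∣ j ∣) ⟩
    (fromSign s * fromSign t) * (m * n)  ≈⟨ *-interchange _ _ _ _ ⟩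
    (fromSign s * m) * (fromSign t * n)  ≈⟨ *-cong (fromℤ-signAbs i) (fromℤ-signAbs j) ⟨
    fromℤ i * fromℤ j                    ∎
    where
    s t : Sign
    s = ℤ.sign i
    t = ℤ.sign j
    m n : Carrier
    m = ℤ.∣ i ∣ × 1#
    n = ℤ.∣ j ∣ × 1#

  fromℤ-⊖ : ∀ m n → fromℤ (m ℤ.⊖ n) ≈ m × 1# - n × 1#
  fromℤ-⊖ m       zero    = sym (trans (+-congˡ -0#≈0#) (+-identityʳ _))
  fromℤ-⊖ zero    (suc n) = sym (+-identityˡ _)
  fromℤ-⊖ (suc m) (suc n) = begin
    fromℤ (suc m ℤ.⊖ suc n)    ≡⟨ ≡.cong fromℤ (ℤ.[1+m]⊖[1+n]≡m⊖n m n) ⟩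
    fromℤ (m ℤ.⊖ n)            ≈⟨ fromℤ-⊖ m n ⟩
    M - N                      ≈⟨ +-identityˡ _ ⟨
    0# + (M - N)               ≈⟨ +-congʳ (-‿inverseʳ 1#) ⟨
    (1# - 1#) + (M - N)        ≈⟨ +-interchange _ _ _ _ ⟩
    (1# + M) + (- 1# - N)      ≈⟨ +-congˡ (-‿+-comm 1# N) ⟩
    (1# + M) - (1# + N)        ≈⟨ +-cong (1+× m 1#) (-‿cong (1+× n 1#)) ⟨
    suc m × 1# - suc n × 1#    ∎
    where
    M N : Carrier
    M = m × 1#
    N = n × 1#

  fromℤ-+ : ∀ i j → fromℤ (i ℤ.+ j) ≈ fromℤ i + fromℤ j
  fromℤ-+ (+ m)    (+ n)    = ×-homo-+ 1# m n
  fromℤ-+ (+ m)    -[1+ n ] = fromℤ-⊖ m (suc n)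
  fromℤ-+ -[1+ m ] (+ n)    = trans (fromℤ-⊖ n (suc m)) (+-comm _ _)
  fromℤ-+ -[1+ m ] -[1+ n ] = begin
    - (suc (suc (m ℕ.+ n)) × 1#)     ≡⟨ ≡.cong (λ k → - (k × 1#)) (ℕ.+-suc (suc m) n) ⟨
    - ((suc m ℕ.+ suc n) × 1#)       ≈⟨ -‿cong (×-homo-+ 1# (suc m) (suc n)) ⟩
    - (suc m × 1# + suc n × 1#)      ≈⟨ -‿+-comm _ _ ⟨
    - (suc m × 1#) + - (suc n × 1#)  ∎

  fromℤ-neg : ∀ i → fromℤ (ℤ.- i) ≈ - fromℤ i
  fromℤ-neg -[1+ n ]  = sym (-‿involutive _)
  fromℤ-neg (+ zero)  = sym -0#≈0#
  fromℤ-neg (+ suc n) = refl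

  fromℤ-homomorphism : ℤ.+-*-rawRing -Raw-AlmostCommutative⟶ fromCommutativeRing R
  fromℤ-homomorphism = record
    { ⟦_⟧    = fromℤ
    ; +-homo = fromℤ-+
    ; *-homo = fromℤ-*
    ; -‿homo = fromℤ-neg
    ; 0-homo = refl
    ; 1-homo = refl
    }

  fromℤ-≟ : ∀ i j → Maybe (fromℤ i ≈ fromℤ j)
  fromℤ-≟ i j with i ℤ.≟ j
  ... | yes ≡.refl = just refl
  ... | no _       = nothing

  open import Algebra.Solver.Ring ℤ.+-*-rawRing (fromCommutativeRing R)
    fromℤ-homomorphism fromℤ-≟ public

  1ₚ : ∀ {n} → Polynomial n
  1ₚ = con (+ 1)

module FieldProperties {c ℓ : Level} (F : Field c ℓ) where
  open Field F
  open FieldOps F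
  open ℤ-RingSolver commutativeRing
  open import Algebra.Properties.CommutativeSemigroup *-commutativeSemigroup
    using (xy∙z≈xz∙y; x∙yz≈y∙xz) renaming (interchange to *-interchange)
  open import Relation.Binary.Reasoning.Setoid setoid

  1≉0 : 1# ≉ 0#
  1≉0 1≈0 = 0≉1 (sym 1≈0)

  *-≉0 : ∀ {x y} → x ≉ 0# → y ≉ 0# → x * y ≉ 0#
  *-≉0 {x} {y} x≉0 y≉0 xy≈0 = 0≉1 (begin
    0#                         ≈⟨ zeroˡ _ ⟨
    0# * (x ⁻¹ * y ⁻¹)         ≈⟨ *-congʳ xy≈0 ⟨
    x * y * (x ⁻¹ * y ⁻¹)      ≈⟨ *-interchange x y (x ⁻¹) (y ⁻¹) ⟩
    x * x ⁻¹ * (y * y ⁻¹)      ≈⟨ *-cong (⁻¹-inverse x x≉0) (⁻¹-inverse y y≉0) ⟩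
    1# * 1#                    ≈⟨ *-identityˡ 1# ⟩
    1#                         ∎)

  *-≉0ˡ : ∀ {x y} → x * y ≉ 0# → x ≉ 0#
  *-≉0ˡ {x} {y} xy≉0 x≈0 = xy≉0 (trans (*-congʳ x≈0) (zeroˡ y))

  *-≉0ʳ : ∀ {x y} → x * y ≉ 0# → y ≉ 0#
  *-≉0ʳ {x} {y} xy≉0 y≈0 = xy≉0 (trans (*-congˡ y≈0) (zeroʳ x))

  ^′-≉0 : ∀ {x} → x ≉ 0# → ∀ n → x ^′ n ≉ 0#
  ^′-≉0 x≉0 zero    = 1≉0
  ^′-≉0 x≉0 (suc n) = *-≉0 (^′-≉0 x≉0 n) x≉0

  ⁻¹-inverseˡ : ∀ {x} → x ≉ 0# → x ⁻¹ * x ≈ 1#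
  ⁻¹-inverseˡ {x} x≉0 = trans (*-comm _ _) (⁻¹-inverse x x≉0)

  ⁻¹-≉0 : ∀ {x} → x ≉ 0# → x ⁻¹ ≉ 0#
  ⁻¹-≉0 {x} x≉0 x⁻¹≈0 = 0≉1 (begin
    0#          ≈⟨ zeroʳ x ⟨
    x * 0#      ≈⟨ *-congˡ x⁻¹≈0 ⟨
    x * x ⁻¹    ≈⟨ ⁻¹-inverse x x≉0 ⟩
    1#          ∎)

  ⁻¹-unique : ∀ {x y} → x * y ≈ 1# → x ⁻¹ ≈ y
  ⁻¹-unique {x} {y} xy≈1 = begin
    x ⁻¹              ≈⟨ *-identityʳ _ ⟨
    x ⁻¹ * 1#         ≈⟨ *-congˡ xy≈1 ⟨
    x ⁻¹ * (x * y)    ≈⟨ *-assoc _ _ _ ⟨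
    x ⁻¹ * x * y      ≈⟨ *-congʳ (⁻¹-inverseˡ x≉0) ⟩
    1# * y            ≈⟨ *-identityˡ y ⟩
    y                 ∎
    where
    x≉0 : x ≉ 0#
    x≉0 x≈0 = 0≉1 (trans (sym (zeroˡ y)) (trans (*-congʳ (sym x≈0)) xy≈1))

  ⁻¹-distrib-* : ∀ {x y} → x ≉ 0# → y ≉ 0# → (x * y) ⁻¹ ≈ x ⁻¹ * y ⁻¹
  ⁻¹-distrib-* {x} {y} x≉0 y≉0 = ⁻¹-unique (begin
    x * y * (x ⁻¹ * y ⁻¹)      ≈⟨ *-interchange x y (x ⁻¹) (y ⁻¹) ⟩
    x * x ⁻¹ * (y * y ⁻¹)      ≈⟨ *-cong (⁻¹-inverse x x≉0) (⁻¹-inverse y y≉0) ⟩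
    1# * 1#                    ≈⟨ *-identityˡ 1# ⟩
    1#                         ∎)

  ∕-cong : ∀ {u u′ v v′} → u ≈ u′ → v ≈ v′ → u ∕ v ≈ u′ ∕ v′
  ∕-cong u≈u′ v≈v′ = *-cong u≈u′ (⁻¹-cong v≈v′)

  ∕-≉0 : ∀ {u v} → u ≉ 0# → v ≉ 0# → u ∕ v ≉ 0#
  ∕-≉0 u≉0 v≉0 = *-≉0 u≉0 (⁻¹-≉0 v≉0)

  ∕-*-cancelʳ : ∀ {v} → v ≉ 0# → ∀ u → u ∕ v * v ≈ u
  ∕-*-cancelʳ {v} v≉0 u = trans (*-assoc u _ v) (trans (*-congˡ (⁻¹-inverseˡ v≉0)) (*-identityʳ u))

  *-∕-cancelʳ : ∀ {v} → v ≉ 0# → ∀ u → u * v ∕ v ≈ u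
  *-∕-cancelʳ {v} v≉0 u = trans (*-assoc u v _) (trans (*-congˡ (⁻¹-inverse v v≉0)) (*-identityʳ u))

  ∕-*-∕ : ∀ {v w} → v ≉ 0# → w ≉ 0# → ∀ u u′ → (u ∕ v) * (u′ ∕ w) ≈ (u * u′) ∕ (v * w)
  ∕-*-∕ v≉0 w≉0 u u′ = trans (*-interchange u _ u′ _) (*-congˡ (sym (⁻¹-distrib-* v≉0 w≉0)))

  ∕-cross : ∀ {u u′ v w} → v ≉ 0# → w ≉ 0# → u * w ≈ u′ * v → u ∕ v ≈ u′ ∕ w
  ∕-cross {u} {u′} {v} {w} v≉0 w≉0 uw≈u′v = begin
    u ∕ v                      ≈⟨ *-∕-cancelʳ w≉0 (u ∕ v) ⟨
    u ∕ v * w ∕ w              ≈⟨ *-congʳ (xy∙z≈xz∙y u _ w) ⟩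
    u * w ∕ v ∕ w              ≈⟨ *-congʳ (*-congʳ uw≈u′v) ⟩
    u′ * v ∕ v ∕ w             ≈⟨ *-congʳ (*-∕-cancelʳ v≉0 u′) ⟩
    u′ ∕ w                     ∎

  1⊖∕ : ∀ {v} → v ≉ 0# → ∀ u → 1# ⊖ u ∕ v ≈ (v ⊖ u) ∕ v
  1⊖∕ {v} v≉0 u = begin
    1# ⊖ u ∕ v                 ≈⟨ +-congʳ (⁻¹-inverse v v≉0) ⟨
    v * v ⁻¹ ⊖ u * v ⁻¹        ≈⟨ solve 3 (λ v i u → v :* i :- u :* i := (v :- u) :* i) refl v (v ⁻¹) u ⟩
    (v ⊖ u) ∕ v                ∎

  *-[1⊖∕*] : ∀ {z} → z ≉ 0# → ∀ u y → z * (1# ⊖ u ∕ z * y) ≈ z ⊖ u * y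
  *-[1⊖∕*] {z} z≉0 u y = begin
    z * (1# ⊖ u ∕ z * y)       ≈⟨ solve 4 (λ z u i y → z :* (1ₚ :- u :* i :* y) := z :- u :* y :* (z :* i)) refl z u (z ⁻¹) y ⟩
    z ⊖ u * y * (z * z ⁻¹)     ≈⟨ +-congˡ (-‿cong (trans (*-congˡ (⁻¹-inverse z z≉0)) (*-identityʳ _))) ⟩
    z ⊖ u * y                  ∎

  *-[1⊖∕] : ∀ {z} → z ≉ 0# → ∀ u → z * (1# ⊖ u ∕ z) ≈ z ⊖ u
  *-[1⊖∕] {z} z≉0 u = begin
    z * (1# ⊖ u ∕ z)           ≈⟨ *-congˡ (+-congˡ (-‿cong (*-identityʳ _))) ⟨
    z * (1# ⊖ u ∕ z * 1#)      ≈⟨ *-[1⊖∕*] z≉0 u 1# ⟩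
    z ⊖ u * 1#                 ≈⟨ +-congˡ (-‿cong (*-identityʳ u)) ⟩
    z ⊖ u                      ∎

  ^′-distribˡ-+-* : ∀ p m n → p ^′ (m ℕ.+ n) ≈ p ^′ m * p ^′ n
  ^′-distribˡ-+-* p zero    n = sym (*-identityˡ _)
  ^′-distribˡ-+-* p (suc m) n = begin
    p ^′ (m ℕ.+ n) * p         ≈⟨ *-congʳ (^′-distribˡ-+-* p m n) ⟩
    p ^′ m * p ^′ n * p        ≈⟨ xy∙z≈xz∙y _ _ _ ⟩
    p ^′ m * p * p ^′ n        ∎

  ^′-double : ∀ p k → p ^′ (2 ℕ.* k) ≈ p ^′ k * p ^′ k
  ^′-double p k = begin
    p ^′ (k ℕ.+ (k ℕ.+ 0))     ≈⟨ ^′-distribˡ-+-* p k (k ℕ.+ 0) ⟩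
    p ^′ k * p ^′ (k ℕ.+ 0)    ≡⟨ ≡.cong (λ m → p ^′ k * p ^′ m) (ℕ.+-identityʳ k) ⟩
    p ^′ k * p ^′ k            ∎

  ^′-cube : ∀ p k → (p ^′ 3) ^′ k ≈ p ^′ k * p ^′ k * p ^′ k
  ^′-cube p zero    = solve 0 (1ₚ := 1ₚ :* 1ₚ :* 1ₚ) refl
  ^′-cube p (suc k) = begin
    (p ^′ 3) ^′ k * p ^′ 3     ≈⟨ *-congʳ (^′-cube p k) ⟩
    x * x * x * (1# * p * p * p)
      ≈⟨ solve 2 (λ x p → x :* x :* x :* (1ₚ :* p :* p :* p) := x :* p :* (x :* p) :* (x :* p)) refl x p ⟩
    x * p * (x * p) * (x * p)  ∎
    where
    x : Carrier
    x = p ^′ k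

  poch-cong : ∀ {z z′} p k → z ≈ z′ → poch z p k ≈ poch z′ p k
  poch-cong p zero    z≈z′ = refl
  poch-cong p (suc k) z≈z′ = *-cong (poch-cong p k z≈z′) (+-congˡ (-‿cong (*-congʳ z≈z′)))

  poch-unfoldˡ : ∀ z p k → poch z p (suc k) ≈ (1# ⊖ z) * poch (z * p) p k
  poch-unfoldˡ z p zero    = solve 1 (λ z → 1ₚ :* (1ₚ :- z :* 1ₚ) := (1ₚ :- z) :* 1ₚ) refl z
  poch-unfoldˡ z p (suc k) = begin
    poch z p (suc k) * (1# ⊖ z * (p ^′ k * p))
      ≈⟨ *-congʳ (poch-unfoldˡ z p k) ⟩
    (1# ⊖ z) * poch (z * p) p k * (1# ⊖ z * (p ^′ k * p))
      ≈⟨ solve 4 (λ z p P x → (1ₚ :- z) :* P :* (1ₚ :- z :* (x :* p)) := (1ₚ :- z) :* (P :* (1ₚ :- z :* p :* x))) refl z p (poch (z * p) p k) (p ^′ k) ⟩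
    (1# ⊖ z) * (poch (z * p) p k * (1# ⊖ z * p * p ^′ k))
      ∎

  sumTo-telescoping : ∀ n (f g r : ℕ → Carrier) (A B : Carrier) →
    (∀ k → k < n → f k ≈ A * g k + B * (r k ⊖ r (suc k))) →
    sumTo n f ≈ A * sumTo n g + B * (r 0 ⊖ r n)
  sumTo-telescoping zero    f g r A B _    =
    solve 3 (λ A B r₀ → con (+ 0) := A :* con (+ 0) :+ B :* (r₀ :- r₀)) refl A B (r 0)
  sumTo-telescoping (suc n) f g r A B f≈ = begin
    sumTo n f + f n
      ≈⟨ +-cong (sumTo-telescoping n f g r A B (λ k k<n → f≈ k (ℕ.m<n⇒m<1+n k<n))) (f≈ n ℕ.≤-refl) ⟩
    A * sumTo n g + B * (r 0 ⊖ r n) + (A * g n + B * (r n ⊖ r (suc n)))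
      ≈⟨ solve 7 (λ A B G g r₀ rₙ r₁ → A :* G :+ B :* (r₀ :- rₙ) :+ (A :* g :+ B :* (rₙ :- r₁)) := A :* (G :+ g) :+ B :* (r₀ :- r₁))
           refl A B (sumTo n g) (g n) (r 0) (r n) (r (suc n)) ⟩
    A * (sumTo n g + g n) + B * (r 0 ⊖ r (suc n))
      ∎

  ∕-*-*-cancel : ∀ {v} → v ≉ 0# → ∀ u w → u ∕ v * (w * v) ≈ u * w
  ∕-*-*-cancel {v} v≉0 u w = begin
    u * v ⁻¹ * (w * v)        ≈⟨ solve 4 (λ u i w v → u :* i :* (w :* v) := u :* w :* (i :* v)) refl u (v ⁻¹) w v ⟩
    u * w * (v ⁻¹ * v)        ≈⟨ *-congˡ (⁻¹-inverseˡ v≉0) ⟩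
    u * w * 1#                ≈⟨ *-identityʳ _ ⟩
    u * w                     ∎

  poch-∕-unfoldˡ : ∀ {z} → z ≉ 0# → ∀ u p k →
    poch (u ∕ z) p k * (z ⊖ u * p ^′ k) ≈ (z ⊖ u) * poch (u ∕ z * p) p k
  poch-∕-unfoldˡ {z} z≉0 u p k = begin
    poch (u ∕ z) p k * (z ⊖ u * p ^′ k)             ≈⟨ *-congˡ (*-[1⊖∕*] z≉0 u (p ^′ k)) ⟨
    poch (u ∕ z) p k * (z * (1# ⊖ u ∕ z * p ^′ k))  ≈⟨ x∙yz≈y∙xz _ _ _ ⟩
    z * poch (u ∕ z) p (suc k)                      ≈⟨ *-congˡ (poch-unfoldˡ (u ∕ z) p k) ⟩
    z * ((1# ⊖ u ∕ z) * poch (u ∕ z * p) p k)       ≈⟨ *-assoc _ _ _ ⟨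
    z * (1# ⊖ u ∕ z) * poch (u ∕ z * p) p k         ≈⟨ *-congʳ (*-[1⊖∕] z≉0 u) ⟩
    (z ⊖ u) * poch (u ∕ z * p) p k                  ∎

module Recurrence {f ℓ : Level} (F : Field f ℓ) where
  open Field F
  open FieldOps F
  open FieldProperties F
  open ℤ-RingSolver commutativeRing
  open import Algebra.Properties.CommutativeSemigroup *-commutativeSemigroup
    using (xy∙z≈xz∙y; xy∙z≈y∙xz)
  open import Relation.Binary.Properties.Setoid setoid using (≉-respˡ)
  open import Relation.Binary.Reasoning.Setoid setoid

  Ωterm : (q a b c : Carrier) → ℕ → Carrier
  Ωterm q a b c k = (q ^′ k) * poch (b ∕ q) q k * poch (c * q) q (2 ℕ.* k) ∕ Ωden q a b c k

  module Contiguous (q a b c : Carrier) (q≉0 : q ≉ 0#) (a≉0 : a ≉ 0#) where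

    β γ δ : Carrier
    β = b ∕ q
    γ = c ∕ (a * q)
    δ = b * c ∕ q

    boundaryDen boundary : ℕ → Carrier
    boundaryDen n = poch (a * q ^′ 2) q n * poch γ q n * poch δ (q ^′ 3) n
    boundary n = poch β q n * poch c q (2 ℕ.* n) ∕ boundaryDen n

    Anum Aden Bden K coeffA coeffB : Carrier
    Anum   = c * (q ⊖ b) * poch (a * q) q 2
    Aden   = (b ⊖ a * q ^′ 3) * (1# ⊖ c) * (a * q ⊖ c)
    Bden   = (b ⊖ a * q ^′ 3) * (1# ⊖ c)
    K      = (1# ⊖ a * q ^′ 2) * (q ⊖ b * c)
    coeffA = Anum ∕ Aden
    coeffB = q * (1# ⊖ a * q ^′ 2) * (1# ⊖ δ) ∕ Bden

    aq≉0 : a * q ≉ 0#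
    aq≉0 = *-≉0 a≉0 q≉0

    coeffB-cleared : coeffB ≈ K ∕ Bden
    coeffB-cleared = ∕-cong (trans (xy∙z≈y∙xz q _ _) (*-congˡ (*-[1⊖∕] q≉0 (b * c)))) refl

    boundary-zero : boundary 0 ≈ 1#
    boundary-zero = begin
      1# * 1# ∕ (1# * 1# * 1#)   ≈⟨ ∕-cong (*-identityˡ 1#) (trans (*-identityʳ _) (*-identityˡ 1#)) ⟩
      1# ∕ 1#                    ≈⟨ *-identityˡ _ ⟩
      1# ⁻¹                      ≈⟨ ⁻¹-unique (*-identityˡ 1#) ⟩
      1#                         ∎

    a′ b′ c′ : Carrier
    a′ = a ∕ q ^′ 2
    b′ = b * q
    c′ = c ∕ q

    q²≉0 : q ^′ 2 ≉ 0#
    q²≉0 = ^′-≉0 q≉0 2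

    shifted-γ : c′ ∕ (a′ * q) ≈ γ * q
    shifted-γ = begin
      c′ ∕ (a′ * q)           ≈⟨ ∕-cross (*-≉0 (∕-≉0 a≉0 q²≉0) q≉0) aq≉0 cross ⟩
      c * q ∕ (a * q)         ≈⟨ xy∙z≈xz∙y c q _ ⟩
      γ * q                   ∎
      where
      cross : c′ * (a * q) ≈ c * q * (a′ * q)
      cross = begin
        c ∕ q * (a * q)                      ≈⟨ ∕-*-*-cancel q≉0 c a ⟩
        c * a                                ≈⟨ *-identityʳ _ ⟨
        c * a * 1#                           ≈⟨ *-congˡ (⁻¹-inverse (q ^′ 2) q²≉0) ⟨
        c * a * (q ^′ 2 * (q ^′ 2) ⁻¹)       ≈⟨ solve 4 (λ c a q i → c :* a :* (1ₚ :* q :* q :* i) := c :* q :* (a :* i :* q)) refl c a q ((q ^′ 2) ⁻¹) ⟩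
        c * q * (a′ * q)                     ∎

    module Step (k : ℕ) where
      x : Carrier
      x = q ^′ k

      P₁ P₂ P₃ P₄ P₅ D S : Carrier
      P₁ = poch β q k
      P₂ = poch c q (2 ℕ.* k)
      P₃ = poch (a * q ^′ 2) q k
      P₄ = poch γ q k
      P₅ = poch δ (q ^′ 3) k
      D  = P₃ * P₄ * P₅
      S  = poch (b * c * q ^′ 2) (q ^′ 3) k

      -- From k to k + 1, Pᵢ acquires the factor fᵢ (and P₂ the two factors f₂ f₂′).
      f₁ f₂ f₂′ f₃ f₄ f₅ : Carrier
      f₁  = 1# ⊖ β * x
      f₂  = 1# ⊖ c * (x * x)
      f₂′ = 1# ⊖ c * (x * x * q)
      f₃  = 1# ⊖ a * q ^′ 2 * x
      f₄  = 1# ⊖ γ * x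
      f₅  = 1# ⊖ δ * (q ^′ 3) ^′ k

      -- q f₁, a q f₄ and q f₅ with the denominators of β, γ, δ cleared.
      Lβ Lγ Lδ : Carrier
      Lβ = q ⊖ b * x
      Lγ = a * q ⊖ c * x
      Lδ = q ⊖ b * c * (x * x * x)

      Lβ-cleared : q * f₁ ≈ Lβ
      Lβ-cleared = *-[1⊖∕*] q≉0 b x

      Lγ-cleared : a * q * f₄ ≈ Lγ
      Lγ-cleared = *-[1⊖∕*] aq≉0 c x

      Lδ-cleared : q * f₅ ≈ Lδ
      Lδ-cleared = trans (*-congˡ (+-congˡ (-‿cong (*-congˡ (^′-cube q k)))))
                         (*-[1⊖∕*] q≉0 (b * c) (x * x * x))

      boundaryDen-suc : boundaryDen (suc k) ≈ D * (f₃ * f₄ * f₅)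
      boundaryDen-suc = solve 6 (λ P₃ f₃ P₄ f₄ P₅ f₅ →
          P₃ :* f₃ :* (P₄ :* f₄) :* (P₅ :* f₅) := P₃ :* P₄ :* P₅ :* (f₃ :* f₄ :* f₅))
        refl P₃ f₃ P₄ f₄ P₅ f₅

      c-shift : (1# ⊖ c) * poch (c * q) q (2 ℕ.* k) ≈ P₂ * f₂
      c-shift = begin
        (1# ⊖ c) * poch (c * q) q (2 ℕ.* k)  ≈⟨ poch-unfoldˡ c q (2 ℕ.* k) ⟨
        P₂ * (1# ⊖ c * q ^′ (2 ℕ.* k))       ≈⟨ *-congˡ (+-congˡ (-‿cong (*-congˡ (^′-double q k)))) ⟩
        P₂ * f₂                              ∎

      c-step : poch c q (2 ℕ.* suc k) ≈ P₂ * f₂ * f₂′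
      c-step = begin
        poch c q (2 ℕ.* suc k)           ≡⟨ ≡.cong (poch c q) (ℕ.*-suc 2 k) ⟩
        poch c q (suc (suc (2 ℕ.* k)))   ≈⟨ *-cong (*-congˡ (+-congˡ (-‿cong (*-congˡ x²))))
                                                   (+-congˡ (-‿cong (*-congˡ (*-congʳ x²)))) ⟩
        P₂ * f₂ * f₂′                    ∎
        where
        x² : q ^′ (2 ℕ.* k) ≈ x * x
        x² = ^′-double q k

      aq²-shift : P₃ * f₃ ≈ (1# ⊖ a * q ^′ 2) * poch (a * q ^′ 3) q k
      aq²-shift = trans (poch-unfoldˡ (a * q ^′ 2) q k) (*-congˡ (poch-cong q k (*-assoc a (q ^′ 2) q)))

      aq-shift : poch (a * q) q k * (1# ⊖ a * q * x) ≈ (1# ⊖ a * q) * P₃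
      aq-shift = trans (poch-unfoldˡ (a * q) q k)
        (*-congˡ (poch-cong q k (solve 2 (λ a q → a :* q :* q := a :* (1ₚ :* q :* q)) refl a q)))

      β-shift : P₁ * Lβ ≈ (q ⊖ b) * poch b q k
      β-shift = trans (poch-∕-unfoldˡ q≉0 b q k) (*-congˡ (poch-cong q k (∕-*-cancelʳ q≉0 b)))

      γ-shift : P₄ * Lγ ≈ (a * q ⊖ c) * poch (γ * q) q k
      γ-shift = poch-∕-unfoldˡ aq≉0 c q k

      δ-shift : P₅ * Lδ ≈ (q ⊖ b * c) * S
      δ-shift = begin
        P₅ * Lδ                                     ≈⟨ *-congˡ (+-congˡ (-‿cong (*-congˡ (^′-cube q k)))) ⟨
        P₅ * (q ⊖ b * c * (q ^′ 3) ^′ k)            ≈⟨ poch-∕-unfoldˡ q≉0 (b * c) (q ^′ 3) k ⟩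
        (q ⊖ b * c) * poch (δ * q ^′ 3) (q ^′ 3) k  ≈⟨ *-congˡ (poch-cong (q ^′ 3) k (∕-*-*-cancel q≉0 (b * c) (q ^′ 2))) ⟩
        (q ⊖ b * c) * S                             ∎

      shifted-num : q ^′ k * poch (b′ ∕ q) q k * poch (c′ * q) q (2 ℕ.* k) ≈ x * poch b q k * P₂
      shifted-num = *-cong (*-congˡ (poch-cong q k (*-∕-cancelʳ q≉0 b)))
                           (poch-cong q (2 ℕ.* k) (∕-*-cancelʳ q≉0 c))

      shifted-den : Ωden q a′ b′ c′ k ≈ poch (a * q) q k * poch (γ * q) q k * S
      shifted-den = *-cong (*-cong (poch-cong q k a′q³) (poch-cong q k shifted-γ)) (poch-cong (q ^′ 3) k (*-congʳ b′c′))
        where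
        a′q³ : a′ * q ^′ 3 ≈ a * q
        a′q³ = trans (*-congˡ (*-comm (q ^′ 2) q)) (∕-*-*-cancel q²≉0 a q)
        b′c′ : b′ * c′ ≈ b * c
        b′c′ = trans (*-comm _ _) (trans (∕-*-*-cancel q≉0 c b) (*-comm c b))

      ρnum ρden W nT nA nR : Carrier
      ρnum = a * q * Lβ * f₂ * f₂′
      ρden = f₃ * Lγ * Lδ
      W    = Bden * ρden
      nT   = x * f₂ * (b ⊖ a * q ^′ 3) * Lγ
      nA   = c * x * Lβ * (1# ⊖ a * q * x) * f₃
      nR   = ρden ⊖ ρnum

      D≉0 : boundaryDen (suc k) ≉ 0# → D ≉ 0#
      D≉0 D′≉0 = *-≉0ˡ (≉-respˡ boundaryDen-suc D′≉0)

      ρden≉0 : boundaryDen (suc k) ≉ 0# → ρden ≉ 0#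
      ρden≉0 D′≉0 = *-≉0 (*-≉0 f₃≉0 (≉-respˡ Lγ-cleared (*-≉0 aq≉0 f₄≉0))) (≉-respˡ Lδ-cleared (*-≉0 q≉0 f₅≉0))
        where
        f₃f₄f₅≉0 : f₃ * f₄ * f₅ ≉ 0#
        f₃f₄f₅≉0 = *-≉0ʳ (≉-respˡ boundaryDen-suc D′≉0)
        f₃≉0 : f₃ ≉ 0#
        f₃≉0 = *-≉0ˡ (*-≉0ˡ f₃f₄f₅≉0)
        f₄≉0 : f₄ ≉ 0#
        f₄≉0 = *-≉0ʳ (*-≉0ˡ f₃f₄f₅≉0)
        f₅≉0 : f₅ ≉ 0#
        f₅≉0 = *-≉0ʳ f₃f₄f₅≉0

      W≉0 : Bden ≉ 0# → boundaryDen (suc k) ≉ 0# → W ≉ 0#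
      W≉0 Bden≉0 D′≉0 = *-≉0 Bden≉0 (ρden≉0 D′≉0)

      boundary-suc : boundaryDen (suc k) ≉ 0# → boundary (suc k) ≈ boundary k * (ρnum ∕ ρden)
      boundary-suc D′≉0 = begin
        boundary (suc k)                 ≈⟨ ∕-cross D′≉0 (*-≉0 (D≉0 D′≉0) (ρden≉0 D′≉0)) cross ⟩
        P₁ * P₂ * ρnum ∕ (D * ρden)      ≈⟨ ∕-*-∕ (D≉0 D′≉0) (ρden≉0 D′≉0) (P₁ * P₂) ρnum ⟨
        boundary k * (ρnum ∕ ρden)       ∎
        where
        cross : P₁ * f₁ * poch c q (2 ℕ.* suc k) * (D * ρden) ≈ P₁ * P₂ * ρnum * boundaryDen (suc k)
        cross = begin
          P₁ * f₁ * poch c q (2 ℕ.* suc k) * (D * (f₃ * Lγ * Lδ))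
            ≈⟨ *-cong (*-congˡ c-step) (*-congˡ (*-cong (*-congˡ (sym Lγ-cleared)) (sym Lδ-cleared))) ⟩
          P₁ * f₁ * (P₂ * f₂ * f₂′) * (P₃ * P₄ * P₅ * (f₃ * (a * q * f₄) * (q * f₅)))
            ≈⟨ solve 13 (λ P₁ f₁ P₂ f₂ f₂′ P₃ P₄ P₅ f₃ a q f₄ f₅ →
                 P₁ :* f₁ :* (P₂ :* f₂ :* f₂′) :* (P₃ :* P₄ :* P₅ :* (f₃ :* (a :* q :* f₄) :* (q :* f₅)))
                 := P₁ :* P₂ :* (a :* q :* (q :* f₁) :* f₂ :* f₂′) :* (P₃ :* f₃ :* (P₄ :* f₄) :* (P₅ :* f₅)))
                 refl P₁ f₁ P₂ f₂ f₂′ P₃ P₄ P₅ f₃ a q f₄ f₅ ⟩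
          P₁ * P₂ * (a * q * (q * f₁) * f₂ * f₂′) * boundaryDen (suc k)
            ≈⟨ *-congʳ (*-congˡ (*-congʳ (*-congʳ (*-congˡ Lβ-cleared)))) ⟩
          P₁ * P₂ * ρnum * boundaryDen (suc k) ∎

      term-ratio : Ωden q a b c k ≉ 0# → Bden ≉ 0# → boundaryDen (suc k) ≉ 0# →
        Ωterm q a b c k ≈ boundary k * (K * nT ∕ W)
      term-ratio Ωden≉0 Bden≉0 D′≉0 = begin
        Ωterm q a b c k                ≈⟨ ∕-cross Ωden≉0 (*-≉0 (D≉0 D′≉0) (W≉0 Bden≉0 D′≉0)) cross ⟩
        P₁ * P₂ * (K * nT) ∕ (D * W)   ≈⟨ ∕-*-∕ (D≉0 D′≉0) (W≉0 Bden≉0 D′≉0) (P₁ * P₂) (K * nT) ⟨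
        boundary k * (K * nT ∕ W)      ∎
        where
        Cq Aq³ e d h : Carrier
        Cq  = poch (c * q) q (2 ℕ.* k)
        Aq³ = poch (a * q ^′ 3) q k
        e   = b ⊖ a * q ^′ 3
        d   = 1# ⊖ c
        h   = 1# ⊖ a * q ^′ 2
        cross : x * P₁ * Cq * (D * W) ≈ P₁ * P₂ * (K * nT) * (Aq³ * P₄ * S)
        cross = begin
          x * P₁ * Cq * (P₃ * P₄ * P₅ * (e * d * (f₃ * Lγ * Lδ)))
            ≈⟨ solve 11 (λ x P₁ Cq P₃ P₄ P₅ e d f₃ Lγ Lδ →
                 x :* P₁ :* Cq :* (P₃ :* P₄ :* P₅ :* (e :* d :* (f₃ :* Lγ :* Lδ)))
                 := x :* P₁ :* P₄ :* e :* Lγ :* (d :* Cq) :* (P₃ :* f₃) :* (P₅ :* Lδ))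
                 refl x P₁ Cq P₃ P₄ P₅ e d f₃ Lγ Lδ ⟩
          x * P₁ * P₄ * e * Lγ * (d * Cq) * (P₃ * f₃) * (P₅ * Lδ)
            ≈⟨ *-cong (*-cong (*-congˡ c-shift) aq²-shift) δ-shift ⟩
          x * P₁ * P₄ * e * Lγ * (P₂ * f₂) * (h * Aq³) * ((q ⊖ b * c) * S)
            ≈⟨ solve 11 (λ x P₁ P₄ e Lγ P₂ f₂ h Aq³ w S →
                 x :* P₁ :* P₄ :* e :* Lγ :* (P₂ :* f₂) :* (h :* Aq³) :* (w :* S)
                 := P₁ :* P₂ :* (h :* w :* (x :* f₂ :* e :* Lγ)) :* (Aq³ :* P₄ :* S))
                 refl x P₁ P₄ e Lγ P₂ f₂ h Aq³ (q ⊖ b * c) S ⟩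
          P₁ * P₂ * (K * nT) * (Aq³ * P₄ * S) ∎

      shifted-ratio : Ωden q a′ b′ c′ k ≉ 0# → Aden ≉ 0# → Bden ≉ 0# → boundaryDen (suc k) ≉ 0# →
        coeffA * Ωterm q a′ b′ c′ k ≈ boundary k * (K * nA ∕ W)
      shifted-ratio Ωden′≉0 Aden≉0 Bden≉0 D′≉0 = begin
        coeffA * Ωterm q a′ b′ c′ k              ≈⟨ *-congˡ (∕-cong shifted-num shifted-den) ⟩
        Anum ∕ Aden * (x * Pb * P₂ ∕ Den′)       ≈⟨ ∕-*-∕ Aden≉0 Den′≉0 Anum (x * Pb * P₂) ⟩
        Anum * (x * Pb * P₂) ∕ (Aden * Den′)     ≈⟨ ∕-cross (*-≉0 Aden≉0 Den′≉0) (*-≉0 (D≉0 D′≉0) (W≉0 Bden≉0 D′≉0)) cross ⟩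
        P₁ * P₂ * (K * nA) ∕ (D * W)             ≈⟨ ∕-*-∕ (D≉0 D′≉0) (W≉0 Bden≉0 D′≉0) (P₁ * P₂) (K * nA) ⟨
        boundary k * (K * nA ∕ W)                ∎
        where
        Pb PA PG Den′ : Carrier
        Pb   = poch b q k
        PA   = poch (a * q) q k
        PG   = poch (γ * q) q k
        Den′ = PA * PG * S
        Den′≉0 : Den′ ≉ 0#
        Den′≉0 = ≉-respˡ shifted-den Ωden′≉0
        u v e d : Carrier
        u = 1# ⊖ a * q
        v = 1# ⊖ a * q ^′ 2
        e = b ⊖ a * q ^′ 3
        d = 1# ⊖ c
        aq-two : poch (a * q) q 2 ≈ u * v
        aq-two = solve 2 (λ a q →
            1ₚ :* (1ₚ :- a :* q :* 1ₚ) :* (1ₚ :- a :* q :* (1ₚ :* q)) := (1ₚ :- a :* q) :* (1ₚ :- a :* (1ₚ :* q :* q)))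
          refl a q
        cross : Anum * (x * Pb * P₂) * (D * W) ≈ P₁ * P₂ * (K * nA) * (Aden * Den′)
        cross = begin
          c * (q ⊖ b) * poch (a * q) q 2 * (x * Pb * P₂) * (P₃ * P₄ * P₅ * (e * d * (f₃ * Lγ * Lδ)))
            ≈⟨ *-congʳ (*-congʳ (*-congˡ aq-two)) ⟩
          c * (q ⊖ b) * (u * v) * (x * Pb * P₂) * (P₃ * P₄ * P₅ * (e * d * (f₃ * Lγ * Lδ)))
            ≈⟨ solve 15 (λ c qb u v x Pb P₂ P₃ P₄ P₅ e d f₃ Lγ Lδ →
                 c :* qb :* (u :* v) :* (x :* Pb :* P₂) :* (P₃ :* P₄ :* P₅ :* (e :* d :* (f₃ :* Lγ :* Lδ)))
                 := c :* x :* P₂ :* v :* e :* d :* f₃ :* (qb :* Pb) :* (u :* P₃) :* (P₄ :* Lγ) :* (P₅ :* Lδ))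
                 refl c (q ⊖ b) u v x Pb P₂ P₃ P₄ P₅ e d f₃ Lγ Lδ ⟩
          c * x * P₂ * v * e * d * f₃ * ((q ⊖ b) * Pb) * (u * P₃) * (P₄ * Lγ) * (P₅ * Lδ)
            ≈⟨ *-cong (*-cong (*-cong (*-congˡ (sym β-shift)) (sym aq-shift)) γ-shift) δ-shift ⟩
          c * x * P₂ * v * e * d * f₃ * (P₁ * Lβ) * (PA * (1# ⊖ a * q * x)) * ((a * q ⊖ c) * PG) * ((q ⊖ b * c) * S)
            ≈⟨ solve 15 (λ c x P₂ v e d f₃ P₁ Lβ PA g h PG w S →
                 c :* x :* P₂ :* v :* e :* d :* f₃ :* (P₁ :* Lβ) :* (PA :* g) :* (h :* PG) :* (w :* S)
                 := P₁ :* P₂ :* (v :* w :* (c :* x :* Lβ :* g :* f₃)) :* (e :* d :* h :* (PA :* PG :* S)))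
                 refl c x P₂ v e d f₃ P₁ Lβ PA (1# ⊖ a * q * x) (a * q ⊖ c) PG (q ⊖ b * c) S ⟩
          P₁ * P₂ * (K * nA) * (Aden * Den′) ∎

      coeffB-ratio : Bden ≉ 0# → boundaryDen (suc k) ≉ 0# →
        coeffB * (boundary k ⊖ boundary (suc k)) ≈ boundary k * (K * nR ∕ W)
      coeffB-ratio Bden≉0 D′≉0 = begin
        coeffB * (boundary k ⊖ boundary (suc k))
          ≈⟨ *-congˡ (+-congˡ (-‿cong (boundary-suc D′≉0))) ⟩
        coeffB * (boundary k ⊖ boundary k * (ρnum ∕ ρden))
          ≈⟨ solve 3 (λ B R r → B :* (R :- R :* r) := R :* (B :* (1ₚ :- r))) refl coeffB (boundary k) (ρnum ∕ ρden) ⟩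
        boundary k * (coeffB * (1# ⊖ ρnum ∕ ρden))
          ≈⟨ *-congˡ (*-cong coeffB-cleared (1⊖∕ (ρden≉0 D′≉0) ρnum)) ⟩
        boundary k * (K ∕ Bden * (nR ∕ ρden))
          ≈⟨ *-congˡ (∕-*-∕ Bden≉0 (ρden≉0 D′≉0) K nR) ⟩
        boundary k * (K * nR ∕ W) ∎

      numerators : nT ≈ nA + nR
      numerators = solve 5 (λ q a b c x →
          x :* (1ₚ :- c :* (x :* x)) :* (b :- a :* (1ₚ :* q :* q :* q)) :* (a :* q :- c :* x)
          := c :* x :* (q :- b :* x) :* (1ₚ :- a :* q :* x) :* (1ₚ :- a :* (1ₚ :* q :* q) :* x)
            :+ ((1ₚ :- a :* (1ₚ :* q :* q) :* x) :* (a :* q :- c :* x) :* (q :- b :* c :* (x :* x :* x))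
               :- a :* q :* (q :- b :* x) :* (1ₚ :- c :* (x :* x)) :* (1ₚ :- c :* (x :* x :* q))))
        refl q a b c x

      step : Ωden q a b c k ≉ 0# → Ωden q a′ b′ c′ k ≉ 0# → Aden ≉ 0# → Bden ≉ 0# → boundaryDen (suc k) ≉ 0# →
        Ωterm q a b c k ≈ coeffA * Ωterm q a′ b′ c′ k + coeffB * (boundary k ⊖ boundary (suc k))
      step Ωden≉0 Ωden′≉0 Aden≉0 Bden≉0 D′≉0 = begin
        Ωterm q a b c k                    ≈⟨ term-ratio Ωden≉0 Bden≉0 D′≉0 ⟩
        boundary k * (K * nT ∕ W)          ≈⟨ *-congˡ (*-congʳ (*-congˡ numerators)) ⟩
        boundary k * (K * (nA + nR) ∕ W)
          ≈⟨ solve 5 (λ R K A B i → R :* (K :* (A :+ B) :* i) := R :* (K :* A :* i) :+ R :* (K :* B :* i))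
               refl (boundary k) K nA nR (W ⁻¹) ⟩
        boundary k * (K * nA ∕ W) + boundary k * (K * nR ∕ W)
          ≈⟨ +-cong (shifted-ratio Ωden′≉0 Aden≉0 Bden≉0 D′≉0) (coeffB-ratio Bden≉0 D′≉0) ⟨
        coeffA * Ωterm q a′ b′ c′ k + coeffB * (boundary k ⊖ boundary (suc k)) ∎

    boundaryDen-≤′ : ∀ {m n} → m ℕ.≤′ n → boundaryDen n ≉ 0# → boundaryDen m ≉ 0#
    boundaryDen-≤′ ℕ.≤′-refl              ≉0 = ≉0
    boundaryDen-≤′ (ℕ.≤′-step {n} m≤′n) ≉0 = boundaryDen-≤′ m≤′n (Step.D≉0 n ≉0)

theorem3p2 : ∀ {c′ ℓ : Level} (F : Field c′ ℓ) →
    let open Field F in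
    let open FieldOps F in
    (q a b c : Carrier) (n : ℕ) →
    ¬ (q ≈ 0#) → ¬ (a ≈ 0#) →
    (∀ k → k < n → ¬ (Ωden q a b c k ≈ 0#)) →
    (∀ k → k < n → ¬ (Ωden q (a ∕ q ^′ 2) (b * q) (c ∕ q) k ≈ 0#)) →
    ¬ ((b ⊖ a * q ^′ 3) ≈ 0#) → ¬ ((1# ⊖ c) ≈ 0#) → ¬ ((a * q ⊖ c) ≈ 0#) →
    ¬ ((poch (a * q ^′ 2) q n * poch (c ∕ (a * q)) q n * poch (b * c ∕ q) (q ^′ 3) n) ≈ 0#) →
    Ω q n a b c ≈
      (c * (q ⊖ b) * poch (a * q) q 2 ∕ ((b ⊖ a * q ^′ 3) * (1# ⊖ c) * (a * q ⊖ c)))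
        * Ω q n (a ∕ q ^′ 2) (b * q) (c ∕ q)
      + (q * (1# ⊖ a * q ^′ 2) * (1# ⊖ b * c ∕ q) ∕ ((b ⊖ a * q ^′ 3) * (1# ⊖ c)))
        * (1# ⊖ poch (b ∕ q) q n * poch c q (2 Data.Nat.* n)
                 ∕ (poch (a * q ^′ 2) q n * poch (c ∕ (a * q)) q n * poch (b * c ∕ q) (q ^′ 3) n))
theorem3p2 F q a b c n q≉0 a≉0 Ωden≉0 Ωden′≉0 e≉0 d≉0 h≉0 boundaryDen≉0 = begin
  Ω q n a b c
    ≈⟨ sumTo-telescoping n (Ωterm q a b c) (Ωterm q a′ b′ c′) boundary coeffA coeffB step ⟩
  coeffA * Ω q n a′ b′ c′ + coeffB * (boundary 0 ⊖ boundary n)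
    ≈⟨ +-congˡ (*-congˡ (+-congʳ boundary-zero)) ⟩
  coeffA * Ω q n a′ b′ c′ + coeffB * (1# ⊖ boundary n) ∎
  where
  open Field F
  open FieldOps F
  open FieldProperties F
  open Recurrence F
  open Contiguous q a b c q≉0 a≉0
  open import Relation.Binary.Reasoning.Setoid setoid
  step : ∀ k → k < n →
    Ωterm q a b c k ≈ coeffA * Ωterm q a′ b′ c′ k + coeffB * (boundary k ⊖ boundary (suc k))
  step k k<n = Step.step k (Ωden≉0 k k<n) (Ωden′≉0 k k<n) (*-≉0 (*-≉0 e≉0 d≉0) h≉0) (*-≉0 e≉0 d≉0)
    (boundaryDen-≤′ (ℕ.≤⇒≤′ k<n) boundaryDen≉0)
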